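{- Every parallelogram graph is an acyclic trapezoid graph.
   Context: $L_1,L_2$ are two horizontal parallel lines. A trapezoid representation is a family of trapezoids $T_u$, each with two vertices on $L_1$ and two on $L_2$, with all endpoints distinct; $T_u$ has a left line $l(T_u)$ and a right line $r(T_u)$ (segments from $L_1$ to $L_2$). The represented graph has an edge $uv$ iff $T_u\cap T_v\neq\emptyset$. A parallelogram graph is a graph with a trapezoid representation in which every trapezoid is a parallelogram. A permutation representation consists of segments ("lines") from $L_1$ to $L_2$; lines are adjacent iff they cross; $\theta_R(x)$ denotes the angle of line $x$ with $L_2$, and $\Phi_R$ orients each edge $xy$ from $x$ to $y$ iff $\theta_R(x)<\theta_R(y)$. For a trapezoid representation $R$, let $R_P$ be the permutation representation consisting of all lines $l(T_u),r(T_u)$; let $F$ be the directed graph on $V$ with an arc $u\to v$ ($u\neq v$) whenever $\Phi_{R_P}$ has an arc from a line of $T_u$ to a line of $T_v$. $R$ is acyclic if $F$ has no directed cycle, and a trapezoid graph is acyclic if it has an acyclic trapezoid representation. -}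

module Defs where

open import Data.Nat using (ℕ; _<_; _+_)
open import Data.Fin using (Fin)
open import Data.Bool using (Bool; true; false)
open import Data.Product using (_×_; ∃; ∃₂; Σ)
open import Data.Sum using (_⊎_)
open import Relation.Nullary using (¬_)
open import Relation.Binary.PropositionalEquality using (_≡_; _≢_)
open import Relation.Binary.Construct.Closure.Transitive using (TransClosure)

-- Only the relative order of points on L₁ and L₂ matters, so positions on
-- each line are natural numbers.  L₁ is the upper line, L₂ the lower one
-- (at vertical distance 1).

-- A trapezoid: top side [a , b] on L₁, bottom side [c , d] on L₂.
record Trapezoid : Set where
  field
    a b c d : ℕ
    a<b : a < b
    c<d : c < d
open Trapezoid public

record Line : Set where
  constructor line
  field
    top bot : ℕ
open Line public

side : Trapezoid → Bool → Line
side T false = line (a T) (c T)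
side T true  = line (b T) (d T)

record TrapRep (n : ℕ) : Set where
  field
    T : Fin n → Trapezoid
    distinct-top : ∀ u v i j → top (side (T u) i) ≡ top (side (T v) j) → (u ≡ v × i ≡ j)
    distinct-bot : ∀ u v i j → bot (side (T u) i) ≡ bot (side (T v) j) → (u ≡ v × i ≡ j)
open TrapRep public

-- Two trapezoids are disjoint iff one lies strictly to the left of the other
-- (on both lines); T_u ∩ T_v ≠ ∅ is the negation.
LeftOf : Trapezoid → Trapezoid → Set
LeftOf S T = (b S < a T) × (d S < c T)

Intersect : Trapezoid → Trapezoid → Set
Intersect S T = ¬ (LeftOf S T ⊎ LeftOf T S)

Represents : ∀ {n} → TrapRep n → (Fin n → Fin n → Set) → Set
Represents {n} R E = ∀ (u v : Fin n) → u ≢ v →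
  (E u v → Intersect (T R u) (T R v)) × (Intersect (T R u) (T R v) → E u v)

-- Parallelogram: top and bottom sides of equal length (b - a = d - c).
IsParallelogram : Trapezoid → Set
IsParallelogram T = a T + d T ≡ b T + c T

Cross : Line → Line → Set
Cross x y = (top x < top y × bot y < bot x) ⊎ (top y < top x × bot x < bot y)

-- θ(x) < θ(y), where θ(x) is the angle of x with L₂ measured
-- counterclockwise from the positive direction of L₂ at the bottom endpoint:
-- θ(x) = atan2(1, top x - bot x), decreasing in (top x - bot x).
-- So θ(x) < θ(y) iff top x - bot x > top y - bot y.
AngleLt : Line → Line → Set
AngleLt x y = top y + bot x < top x + bot y

PhiArc : Line → Line → Set
PhiArc x y = Cross x y × AngleLt x y

FArc : ∀ {n} → TrapRep n → Fin n → Fin n → Set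
FArc R u v = (u ≢ v) × ∃₂ λ i j → PhiArc (side (T R u) i) (side (T R v) j)

Acyclic : ∀ {n} → TrapRep n → Set
Acyclic {n} R = ∀ (u : Fin n) → ¬ TransClosure (FArc R) u u

IsParallelogramGraph : ∀ n → (Fin n → Fin n → Set) → Set
IsParallelogramGraph n E =
  Σ (TrapRep n) λ R → Represents R E × (∀ u → IsParallelogram (T R u))

IsAcyclicTrapezoidGraph : ∀ n → (Fin n → Fin n → Set) → Set
IsAcyclicTrapezoidGraph n E =
  Σ (TrapRep n) λ R → Represents R E × Acyclic R

module Submission where

-- Every parallelogram representation is acyclic, so every parallelogram graph
-- is an acyclic trapezoid graph, witnessed by the very same representation.
--
-- The angle θ(x) of a line only depends on its "slope" top x - bot x, and
-- θ(x) < θ(y) (the relation AngleLt) is a strict order on lines that is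
-- invariant under replacing a line by a parallel one.  Both sides of a
-- parallelogram T are parallel to its left line l(T).  Hence an arc u → v of
-- F, which compares some side of T_u with some side of T_v, already forces
-- θ(l(T_u)) < θ(l(T_v)).  The angle of the left line is thus a potential that
-- strictly increases along every arc of F, and a relation admitting such a
-- potential into a strict order has no directed cycle.

open import Defs
open import Level using (Level)
open import Data.Nat using (ℕ; _<_; _+_)
open import Data.Nat.Properties
  using (+-cancelʳ-<; +-monoˡ-<; <-irrefl; module ≤-Reasoning; +-commutativeSemigroup)
open import Algebra.Properties.CommutativeSemigroup +-commutativeSemigroup
  using (xy∙z≈xz∙y)
open import Data.Fin using (Fin)
open import Data.Bool using (true; false)
open import Data.Product using (_,_)
open import Relation.Nullary using (¬_)
open import Relation.Binary.Core using (Rel)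
open import Relation.Binary.Definitions using (Transitive)
open import Relation.Binary.PropositionalEquality using (_≡_; refl; sym; cong)
open import Relation.Binary.Construct.Closure.Transitive using (TransClosure; [_]; _∷_)

private
  variable
    ℓ ℓ₁ ℓ₂ : Level
    A B : Set ℓ

potential-increases : (_⇝_ : Rel A ℓ₁) (_<_ : Rel B ℓ₂) (f : A → B) →
  Transitive _<_ → (∀ {x y} → x ⇝ y → f x < f y) →
  ∀ {x y} → TransClosure _⇝_ x y → f x < f y
potential-increases _⇝_ _<_ f <-trans step [ x⇝y ]       = step x⇝y
potential-increases _⇝_ _<_ f <-trans step (x⇝y ∷ y⇝⁺z) =
  <-trans (step x⇝y) (potential-increases _⇝_ _<_ f <-trans step y⇝⁺z)

potential-acyclic : (_⇝_ : Rel A ℓ₁) (_<_ : Rel B ℓ₂) (f : A → B) →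
  Transitive _<_ → (∀ {x} → ¬ (f x < f x)) → (∀ {x y} → x ⇝ y → f x < f y) →
  ∀ x → ¬ TransClosure _⇝_ x x
potential-acyclic _⇝_ _<_ f <-trans <-irr step x cycle =
  <-irr (potential-increases _⇝_ _<_ f <-trans step cycle)

+-rightComm : ∀ m n o → m + n + o ≡ m + o + n
+-rightComm = xy∙z≈xz∙y

-- Two lines are parallel when top x - bot x = top y - bot y.
_∥_ : Line → Line → Set
x ∥ y = top x + bot y ≡ top y + bot x

angle-irrefl : ∀ {x} → ¬ AngleLt x x
angle-irrefl = <-irrefl refl

-- … and transitive (add bot z, resp. bot x, to the hypotheses and cancel bot y).
angle-trans : Transitive AngleLt
angle-trans {x} {y} {z} x<y y<z = +-cancelʳ-< (bot y) _ _ (begin-strict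
  top z + bot x + bot y  ≡⟨ +-rightComm (top z) (bot x) (bot y) ⟩
  top z + bot y + bot x  <⟨ +-monoˡ-< (bot x) y<z ⟩
  top y + bot z + bot x  ≡⟨ +-rightComm (top y) (bot z) (bot x) ⟩
  top y + bot x + bot z  <⟨ +-monoˡ-< (bot z) x<y ⟩
  top x + bot y + bot z  ≡⟨ +-rightComm (top x) (bot y) (bot z) ⟩
  top x + bot z + bot y  ∎)
  where open ≤-Reasoning

angle-respˡ-∥ : ∀ {x x′ y} → x ∥ x′ → AngleLt x y → AngleLt x′ y
angle-respˡ-∥ {x} {x′} {y} x∥x′ x<y = +-cancelʳ-< (bot x) _ _ (begin-strict
  top y + bot x′ + bot x   ≡⟨ +-rightComm (top y) (bot x′) (bot x) ⟩
  top y + bot x + bot x′   <⟨ +-monoˡ-< (bot x′) x<y ⟩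
  top x + bot y + bot x′   ≡⟨ +-rightComm (top x) (bot y) (bot x′) ⟩
  top x + bot x′ + bot y   ≡⟨ cong (_+ bot y) x∥x′ ⟩
  top x′ + bot x + bot y   ≡⟨ +-rightComm (top x′) (bot x) (bot y) ⟩
  top x′ + bot y + bot x   ∎)
  where open ≤-Reasoning

angle-respʳ-∥ : ∀ {x y y′} → y ∥ y′ → AngleLt x y → AngleLt x y′
angle-respʳ-∥ {x} {y} {y′} y∥y′ x<y = +-cancelʳ-< (bot y) _ _ (begin-strict
  top y′ + bot x + bot y   ≡⟨ +-rightComm (top y′) (bot x) (bot y) ⟩
  top y′ + bot y + bot x   ≡⟨ cong (_+ bot x) (sym y∥y′) ⟩
  top y + bot y′ + bot x   ≡⟨ +-rightComm (top y) (bot y′) (bot x) ⟩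
  top y + bot x + bot y′   <⟨ +-monoˡ-< (bot y′) x<y ⟩
  top x + bot y + bot y′   ≡⟨ +-rightComm (top x) (bot y) (bot y′) ⟩
  top x + bot y′ + bot y   ∎)
  where open ≤-Reasoning

leftLine : Trapezoid → Line
leftLine T = side T false

parallelogram-sides-∥ : ∀ T → IsParallelogram T → ∀ i → side T i ∥ leftLine T
parallelogram-sides-∥ T a+d≡b+c false = refl
parallelogram-sides-∥ T a+d≡b+c true  = sym a+d≡b+c

arc-increases-angle : ∀ {n} (R : TrapRep n) → (∀ u → IsParallelogram (T R u)) →
  ∀ {u v} → FArc R u v → AngleLt (leftLine (T R u)) (leftLine (T R v))
arc-increases-angle R par {u} {v} (_ , i , j , _ , θx<θy) =
  angle-respˡ-∥ {x′ = leftLine (T R u)} (parallelogram-sides-∥ (T R u) (par u) i)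
    (angle-respʳ-∥ {x = side (T R u) i} (parallelogram-sides-∥ (T R v) (par v) j) θx<θy)

-- Every parallelogram representation is acyclic.  (AngleLt unfolds to an
-- arithmetic inequality, so its line arguments are passed explicitly.)
parallelogram-acyclic : ∀ {n} (R : TrapRep n) → (∀ u → IsParallelogram (T R u)) →
  Acyclic R
parallelogram-acyclic R par =
  potential-acyclic (FArc R) AngleLt (λ u → leftLine (T R u))
    (λ {x y z} → angle-trans {x} {y} {z}) (λ {u} → angle-irrefl {leftLine (T R u)})
    (arc-increases-angle R par)

lemma2p3 : (n : ℕ) (E : Fin n → Fin n → Set) →
    IsParallelogramGraph n E → IsAcyclicTrapezoidGraph n E
lemma2p3 n E (R , represents , par) = R , represents , parallelogram-acyclic R par
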